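{- Let $M$ be a partial multiplication matrix, and let $\pi^\#\in\mathsf{Grid}^\#(M)$. Then $\pi^\#$ is $M$-indivisible if and only if the orientation digraph $D_{\pi^\#}$ is strongly connected.
   Context: A gridding matrix is a matrix with entries in $\{0,1,-1\}$ ($m$ columns, $n$ rows; $M_{ij}$ in column $i$ from the left, row $j$ from the bottom). An $M$-gridding of a permutation is a division of its plot by $m-1$ vertical and $n-1$ horizontal lines into cells, each point interior to a cell, with cell $ij$ empty if $M_{ij}=0$, increasing if $M_{ij}=1$, decreasing if $M_{ij}=-1$; $\mathsf{Grid}^\#(M)$ is the set of $M$-gridded permutations (permutations with a fixed $M$-gridding). A partial multiplication matrix is a gridding matrix with fixed $c_1,\dots,c_m,r_1,\dots,r_n\in\{\pm1\}$ such that $M_{ij}=c_ir_j$ whenever $M_{ij}\ne0$; column $i$ is oriented left-to-right if $c_i=1$ and right-to-left otherwise, row $j$ bottom-to-top if $r_j=1$ and top-to-bottom otherwise. The orientation digraph $D_{\pi^\#}$ has the points of $\pi^\#$ as vertices and an arc $x\to y$ whenever $x,y$ share a column (resp. row) of the gridding and $x$ precedes $y$ in that column's (resp. row's) orientation. For $M$-gridded $\sigma^\#,\tau^\#$, the $M$-sum $\sigma^\#\boxplus\tau^\#$ is the $M$-gridded permutation whose cell $ij$ contains the points of cell $ij$ of both $\sigma^\#$ and $\tau^\#$, with the points of each keeping their relative positions, and with every point of $\sigma^\#$ preceding every point of $\tau^\#$ in the orientation of each column and of each row. $\pi^\#$ is $M$-divisible if it equals $\sigma^\#\boxplus\tau^\#$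 for nonempty $\sigma^\#,\tau^\#$, and $M$-indivisible otherwise. -}

module Defs where

open import Data.Nat using (ℕ)
open import Data.Fin using (Fin; _<_; _≤_)
open import Data.Sign using (Sign; +; -) renaming (_*_ to _*ₛ_)
open import Data.Sum using (_⊎_; inj₁; inj₂)
open import Data.Product using (Σ; _×_; ∃)
open import Relation.Nullary using (¬_)
open import Relation.Binary.PropositionalEquality using (_≡_; _≢_)
open import Relation.Binary.Construct.Closure.ReflexiveTransitive using (Star)
open import Function.Definitions using (Injective; Bijective)
open import Function.Bundles using (_⇔_)

-- Gridding matrices (m columns, n rows; M i j = entry in column i, row j)

data Entry : Set where
  empty : Entry
  incr  : Entry
  decr  : Entry

GriddingMatrix : ℕ → ℕ → Set
GriddingMatrix m n = Fin m → Fin n → Entry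

signEntry : Sign → Entry
signEntry + = incr
signEntry - = decr

IsPartialMultiplication : ∀ {m n} → GriddingMatrix m n →
                          (Fin m → Sign) → (Fin n → Sign) → Set
IsPartialMultiplication M c r =
  ∀ i j → M i j ≢ empty → M i j ≡ signEntry (c i *ₛ r j)

-- A permutation of length size is an injective map perm : Fin size → Fin size
-- (point at horizontal position p has value perm p).  A gridding by
-- m-1 vertical and n-1 horizontal lines is determined by the (weakly
-- increasing) column of each position and row of each value.

record Gridded (m n : ℕ) : Set where
  field
    size     : ℕ
    perm     : Fin size → Fin size
    perm-inj : Injective _≡_ _≡_ perm
    col      : Fin size → Fin m
    rowV     : Fin size → Fin n
    col-mono : ∀ {p q} → p ≤ q → col p ≤ col q
    row-mono : ∀ {u v} → u ≤ v → rowV u ≤ rowV v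

  row : Fin size → Fin n
  row p = rowV (perm p)

open Gridded public

InGrid : ∀ {m n} → GriddingMatrix m n → Gridded m n → Set
InGrid M π =
  (∀ p → M (col π p) (row π p) ≢ empty) ×
  (∀ p q → p < q → col π p ≡ col π q → row π p ≡ row π q →
     (M (col π p) (row π p) ≡ incr → perm π p < perm π q) ×
     (M (col π p) (row π p) ≡ decr → perm π q < perm π p))

Precedes : ∀ {k} → Sign → Fin k → Fin k → Set
Precedes + a b = a < b
Precedes - a b = b < a

ColPrec : ∀ {m n} (c : Fin m → Sign) (π : Gridded m n) → Fin (size π) → Fin (size π) → Set
ColPrec c π x y = col π x ≡ col π y × Precedes (c (col π x)) x y

RowPrec : ∀ {m n} (r : Fin n → Sign) (π : Gridded m n) → Fin (size π) → Fin (size π) → Set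
RowPrec r π x y = row π x ≡ row π y × Precedes (r (row π x)) (perm π x) (perm π y)

Arc : ∀ {m n} (c : Fin m → Sign) (r : Fin n → Sign) (π : Gridded m n) →
      Fin (size π) → Fin (size π) → Set
Arc c r π x y = ColPrec c π x y ⊎ RowPrec r π x y

StronglyConnected : ∀ {m n} (c : Fin m → Sign) (r : Fin n → Sign) (π : Gridded m n) → Set
StronglyConnected c r π = ∀ x y → Star (Arc c r π) x y

record IsMSum {m n} (c : Fin m → Sign) (r : Fin n → Sign)
              (π σ τ : Gridded m n) : Set where
  field
    e      : Fin (size σ) ⊎ Fin (size τ) → Fin (size π)
    e-bij  : Bijective _≡_ _≡_ e
    colˡ   : ∀ a → col π (e (inj₁ a)) ≡ col σ a
    rowˡ   : ∀ a → row π (e (inj₁ a)) ≡ row σ a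
    colʳ   : ∀ b → col π (e (inj₂ b)) ≡ col τ b
    rowʳ   : ∀ b → row π (e (inj₂ b)) ≡ row τ b
    posˡ   : ∀ a a′ → a < a′ → e (inj₁ a) < e (inj₁ a′)
    valˡ   : ∀ a a′ → perm σ a < perm σ a′ → perm π (e (inj₁ a)) < perm π (e (inj₁ a′))
    posʳ   : ∀ b b′ → b < b′ → e (inj₂ b) < e (inj₂ b′)
    valʳ   : ∀ b b′ → perm τ b < perm τ b′ → perm π (e (inj₂ b)) < perm π (e (inj₂ b′))
    colSep : ∀ a b → col σ a ≡ col τ b → ColPrec c π (e (inj₁ a)) (e (inj₂ b))
    rowSep : ∀ a b → row σ a ≡ row τ b → RowPrec r π (e (inj₁ a)) (e (inj₂ b))

NonEmpty : ∀ {m n} → Gridded m n → Set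
NonEmpty π = Fin (size π)

MDivisible : ∀ {m n} → GriddingMatrix m n → (Fin m → Sign) → (Fin n → Sign) →
             Gridded m n → Set
MDivisible M c r π =
  Σ (Gridded _ _) λ σ → Σ (Gridded _ _) λ τ →
    InGrid M σ × InGrid M τ × NonEmpty σ × NonEmpty τ × IsMSum c r π σ τ

MIndivisible : ∀ {m n} → GriddingMatrix m n → (Fin m → Sign) → (Fin n → Sign) →
               Gridded m n → Set
MIndivisible M c r π = ¬ MDivisible M c r π

-- A set T of points of π that is closed under the arcs of D_π splits π as soon as T and its
-- complement are nonempty: π = (points outside T) ⊞ (points in T), since a point outside T that
-- shares a column or row with a point of T must precede it, or else an arc would leave T.
-- Conversely, in σ ⊞ τ no arc leads from a point of τ back to σ, so no path does either.
-- For indivisible ⇒ strongly connected, take T to be the set of points reachable from x,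
-- obtained by saturating {x} under arcs, which terminates since T grows inside a finite set.
module Submission where

open import Defs
open import Data.Nat using (ℕ)
open import Data.Fin using (Fin)
open import Data.Sign using (Sign)
open import Function.Bundles using (_⇔_)

open import Data.Fin using (zero; suc; cast; _<_; _≤_)
import Data.Fin.Properties as Finₚ
open import Data.Fin.Subset using (Subset; inside; outside; _∈_; _∉_; _⊂_; _⊃_; _∪_; ⁅_⁆; ∁; ∣_∣)
open import Data.Fin.Subset.Properties
  using (_∈?_; p⊆p∪q; q⊆p∪q; x∈p∪q⁻; x∈⁅x⁆; x∈⁅y⁆⇒x≡y; x∈∁p⇒x∉p; x∉p⇒x∈∁p)
open import Data.Fin.Subset.Induction using (⊃-wellFounded)
import Data.Nat as ℕ
import Data.Nat.Properties as ℕₚ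
open import Data.Product using (∃; ∃₂; _×_; _,_; proj₁; proj₂)
open import Data.Sign using (+; -)
open import Data.Sum using (_⊎_; inj₁; inj₂; swap)
open import Data.Vec using (_∷_; tabulate; here; there)
open import Data.Vec.Properties using (lookup∘tabulate; []=⇒lookup; lookup⇒[]=)
open import Function using (_∘_)
open import Function.Bundles using (mk⇔)
open import Function.Definitions using (Injective; Surjective)
open import Induction.WellFounded using (Acc; acc)
open import Relation.Binary.Core using (Rel; _Preserves_⟶_)
import Relation.Binary.Definitions as B
open import Relation.Binary.PropositionalEquality
open import Relation.Binary.Construct.Closure.ReflexiveTransitive using (Star; ε; _◅_; _◅◅_)
open import Relation.Nullary using (¬_; Dec; yes; no; does; ¬?; contradiction)
open import Relation.Nullary.Decidable using (dec-true; _×-dec_; _⊎-dec_)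
open import Relation.Unary using (Pred; Decidable)
open import Relation.Unary.Closure.Base using (Closed)

Precedes? : ∀ {k} s → B.Decidable (Precedes {k} s)
Precedes? + x y = x Finₚ.<? y
Precedes? - x y = y Finₚ.<? x

Precedes-asym : ∀ {k} s → B.Asymmetric (Precedes {k} s)
Precedes-asym + = Finₚ.<-asym
Precedes-asym - = Finₚ.<-asym

≢⇒<⊎> : ∀ {k} {x y : Fin k} → x ≢ y → x < y ⊎ y < x
≢⇒<⊎> {x = x} {y} x≢y with Finₚ.<-cmp x y
... | B.tri< x<y _ _ = inj₁ x<y
... | B.tri≈ _ x≡y _ = contradiction x≡y x≢y
... | B.tri> _ _ y<x = inj₂ y<x

Precedes-connex : ∀ {k} s {x y : Fin k} → x ≢ y → Precedes s x y ⊎ Precedes s y x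
Precedes-connex + = ≢⇒<⊎>
Precedes-connex - = swap ∘ ≢⇒<⊎>

module _ {a ℓ t} {A : Set a} {R : Rel A ℓ} {T : Pred A t} where

  Closed⇒Star-closed : Closed R T → ∀ {x y} → T x → Star R x y → T y
  Closed⇒Star-closed closed Tx ε = Tx
  Closed⇒Star-closed closed Tx (xRz ◅ z⟶y) = Closed⇒Star-closed closed (Closed.next closed Tx xRz) z⟶y

module StrictlyMonotone {k N} {f : Fin k → Fin N} (mono : f Preserves _<_ ⟶ _<_) where

  reflects-< : ∀ {i j} → f i < f j → i < j
  reflects-< {i} {j} fi<fj with Finₚ.<-cmp i j
  ... | B.tri< i<j _ _ = i<j
  ... | B.tri≈ _ refl _ = contradiction fi<fj (Finₚ.<-irrefl refl)
  ... | B.tri> _ _ j<i = contradiction (mono j<i) (Finₚ.<-asym fi<fj)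

  injective : Injective _≡_ _≡_ f
  injective {i} {j} fi≡fj with Finₚ.<-cmp i j
  ... | B.tri< i<j _ _ = contradiction fi≡fj (Finₚ.<⇒≢ (mono i<j))
  ... | B.tri≈ _ i≡j _ = i≡j
  ... | B.tri> _ _ j<i = contradiction (sym fi≡fj) (Finₚ.<⇒≢ (mono j<i))

  monotone : f Preserves _≤_ ⟶ _≤_
  monotone i≤j = ℕₚ.≮⇒≥ (ℕₚ.≤⇒≯ i≤j ∘ reflects-<)

cast-strictMono : ∀ {k l} .(k≡l : k ≡ l) → cast k≡l Preserves _<_ ⟶ _<_
cast-strictMono k≡l {i} {j} = subst₂ ℕ._<_ (sym (Finₚ.toℕ-cast k≡l i)) (sym (Finₚ.toℕ-cast k≡l j))

module _ {N p} {Q : Pred (Fin N) p} (Q? : Decidable Q) where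

  fromDec : Subset N
  fromDec = tabulate (does ∘ Q?)

  ∈-fromDec⁺ : ∀ {x} → Q x → x ∈ fromDec
  ∈-fromDec⁺ {x} Qx = lookup⇒[]= x fromDec (trans (lookup∘tabulate (does ∘ Q?) x) (dec-true (Q? x) Qx))

  ∈-fromDec⁻ : ∀ {x} → x ∈ fromDec → Q x
  ∈-fromDec⁻ {x} x∈ with Q? x | trans (sym (lookup∘tabulate (does ∘ Q?) x)) ([]=⇒lookup x∈)
  ... | yes Qx | _ = Qx
  ... | no _ | ()

enum : ∀ {N} (p : Subset N) → Fin ∣ p ∣ → Fin N
enum (inside ∷ p) zero = zero
enum (inside ∷ p) (suc i) = suc (enum p i)
enum (outside ∷ p) i = suc (enum p i)

enum-∈ : ∀ {N} (p : Subset N) i → enum p i ∈ p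
enum-∈ (inside ∷ p) zero = here
enum-∈ (inside ∷ p) (suc i) = there (enum-∈ p i)
enum-∈ (outside ∷ p) i = there (enum-∈ p i)

enum-strictMono : ∀ {N} (p : Subset N) → enum p Preserves _<_ ⟶ _<_
enum-strictMono (inside ∷ p) {zero} {suc j} _ = ℕ.z<s
enum-strictMono (inside ∷ p) {suc i} {suc j} (ℕ.s<s i<j) = ℕ.s<s (enum-strictMono p i<j)
enum-strictMono (outside ∷ p) i<j = ℕ.s<s (enum-strictMono p i<j)

index : ∀ {N} {p : Subset N} {x} → x ∈ p → Fin ∣ p ∣
index {p = inside ∷ p} here = zero
index {p = inside ∷ p} (there x∈p) = suc (index x∈p)
index {p = outside ∷ p} (there x∈p) = index x∈p

enum-index : ∀ {N} {p : Subset N} {x} (x∈p : x ∈ p) → enum p (index x∈p) ≡ x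
enum-index {p = inside ∷ p} here = refl
enum-index {p = inside ∷ p} (there x∈p) = cong suc (enum-index x∈p)
enum-index {p = outside ∷ p} (there x∈p) = cong suc (enum-index x∈p)

record Sorting {k N} (g : Fin k → Fin N) : Set where
  field
    rank              : Fin k → Fin k
    unrank            : Fin k → Fin N
    unrank-strictMono : unrank Preserves _<_ ⟶ _<_
    unrank∘rank       : ∀ a → unrank (rank a) ≡ g a

  rank-reflects-< : ∀ {a b} → rank a < rank b → g a < g b
  rank-reflects-< {a} {b} = subst₂ _<_ (unrank∘rank a) (unrank∘rank b) ∘ unrank-strictMono

  rank-preserves-< : ∀ {a b} → g a < g b → rank a < rank b
  rank-preserves-< {a} {b} =
    StrictlyMonotone.reflects-< unrank-strictMono ∘ subst₂ _<_ (sym (unrank∘rank a)) (sym (unrank∘rank b))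

  rank-injective : Injective _≡_ _≡_ g → Injective _≡_ _≡_ rank
  rank-injective g-inj {a} {b} ra≡rb = g-inj (begin
    g a               ≡⟨ unrank∘rank a ⟨
    unrank (rank a)   ≡⟨ cong unrank ra≡rb ⟩
    unrank (rank b)   ≡⟨ unrank∘rank b ⟩
    g b               ∎)
    where open ≡-Reasoning

sort : ∀ {k N} (g : Fin k → Fin N) → Injective _≡_ _≡_ g → Sorting g
sort {k} {N} g g-inj = record
  { rank              = cast (sym k≡∣image∣) ∘ index′
  ; unrank            = enum image ∘ cast k≡∣image∣
  ; unrank-strictMono = enum-strictMono image ∘ cast-strictMono k≡∣image∣
  ; unrank∘rank       = λ a → trans (cong (enum image) (cast-cancel (index′ a))) (enum-index (∈-image a))
  }
  where
  inImage? : Decidable (λ v → ∃ λ a → g a ≡ v)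
  inImage? v = Finₚ.any? (λ a → g a Finₚ.≟ v)

  image : Subset N
  image = fromDec inImage?

  ∈-image : ∀ a → g a ∈ image
  ∈-image a = ∈-fromDec⁺ inImage? (a , refl)

  index′ : Fin k → Fin ∣ image ∣
  index′ = index ∘ ∈-image

  preimage : Fin ∣ image ∣ → Fin k
  preimage v = proj₁ (∈-fromDec⁻ inImage? (enum-∈ image v))

  g∘preimage : ∀ v → g (preimage v) ≡ enum image v
  g∘preimage v = proj₂ (∈-fromDec⁻ inImage? (enum-∈ image v))

  index′-injective : Injective _≡_ _≡_ index′
  index′-injective {a} {b} eq =
    g-inj (trans (sym (enum-index (∈-image a))) (trans (cong (enum image) eq) (enum-index (∈-image b))))

  preimage-injective : Injective _≡_ _≡_ preimage
  preimage-injective {v} {w} eq = StrictlyMonotone.injective (enum-strictMono image)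
    (trans (sym (g∘preimage v)) (trans (cong g eq) (g∘preimage w)))

  k≡∣image∣ : k ≡ ∣ image ∣
  k≡∣image∣ = Finₚ.cantor-schröder-bernstein index′-injective preimage-injective

  cast-cancel : ∀ v → cast k≡∣image∣ (cast (sym k≡∣image∣) v) ≡ v
  cast-cancel = Finₚ.cast-involutive k≡∣image∣ (sym k≡∣image∣)

module Restriction {m n} (π : Gridded m n) (P : Subset (size π)) where

  point : Fin ∣ P ∣ → Fin (size π)
  point = enum P

  perm∘point-injective : Injective _≡_ _≡_ (perm π ∘ point)
  perm∘point-injective = StrictlyMonotone.injective (enum-strictMono P) ∘ perm-inj π

  open Sorting (sort (perm π ∘ point) perm∘point-injective) public

  restrict : Gridded m n
  restrict = record
    { size     = ∣ P ∣
    ; perm     = rank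
    ; perm-inj = rank-injective perm∘point-injective
    ; col      = col π ∘ point
    ; rowV     = rowV π ∘ unrank
    ; col-mono = λ a≤b → col-mono π (StrictlyMonotone.monotone (enum-strictMono P) a≤b)
    ; row-mono = λ u≤v → row-mono π (StrictlyMonotone.monotone unrank-strictMono u≤v)
    }

  row-restrict : ∀ a → row restrict a ≡ row π (point a)
  row-restrict a = cong (rowV π) (unrank∘rank a)

  restrict-inGrid : ∀ M → InGrid M π → InGrid M restrict
  restrict-inGrid M (occupied , oriented) = occupied′ , oriented′
    where
    same-cell : ∀ a → M (col restrict a) (row restrict a) ≡ M (col π (point a)) (row π (point a))
    same-cell a = cong (M _) (row-restrict a)

    occupied′ : ∀ a → M (col restrict a) (row restrict a) ≢ empty
    occupied′ a = occupied (point a) ∘ trans (sym (same-cell a))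

    oriented′ : ∀ a b → a < b → col restrict a ≡ col restrict b → row restrict a ≡ row restrict b →
      (M (col restrict a) (row restrict a) ≡ incr → rank a < rank b) ×
      (M (col restrict a) (row restrict a) ≡ decr → rank b < rank a)
    oriented′ a b a<b same-col same-row
      with oriented (point a) (point b) (enum-strictMono P a<b) same-col
                    (trans (sym (row-restrict a)) (trans same-row (row-restrict b)))
    ... | incr⇒< , decr⇒> = rank-preserves-< ∘ incr⇒< ∘ trans (sym (same-cell a)) ,
                            rank-preserves-< ∘ decr⇒> ∘ trans (sym (same-cell a))

p⊂p∪⁅x⁆ : ∀ {N} {p : Subset N} {x} → x ∉ p → p ⊂ p ∪ ⁅ x ⁆
p⊂p∪⁅x⁆ {p = p} {x} x∉p = p⊆p∪q ⁅ x ⁆ , x , q⊆p∪q p ⁅ x ⁆ (x∈⁅x⁆ x) , x∉p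

module Reachability {N ℓ} {R : Rel (Fin N) ℓ} (R? : B.Decidable R) (x : Fin N) where

  ClosedReachableSet : Set ℓ
  ClosedReachableSet = ∃ λ (T : Subset N) → x ∈ T × Closed R (_∈ T) × (∀ {y} → y ∈ T → Star R x y)

  private
    Exit : Subset N → Fin N → Fin N → Set ℓ
    Exit S z w = z ∈ S × w ∉ S × R z w

    exit? : ∀ S → Dec (∃₂ (Exit S))
    exit? S = Finₚ.any? λ z → Finₚ.any? λ w → z ∈? S ×-dec ¬? (w ∈? S) ×-dec R? z w

  saturate : ∀ S → Acc _⊃_ S → x ∈ S → (∀ {y} → y ∈ S → Star R x y) → ClosedReachableSet
  saturate S (acc larger) x∈S reach with exit? S
  ... | yes (z , w , z∈S , w∉S , zRw) =
    saturate (S ∪ ⁅ w ⁆) (larger (p⊂p∪⁅x⁆ w∉S)) (p⊆p∪q ⁅ w ⁆ x∈S) reach′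
    where
    reach′ : ∀ {y} → y ∈ S ∪ ⁅ w ⁆ → Star R x y
    reach′ y∈ with x∈p∪q⁻ S ⁅ w ⁆ y∈
    ... | inj₁ y∈S = reach y∈S
    ... | inj₂ y∈⁅w⁆ rewrite x∈⁅y⁆⇒x≡y w y∈⁅w⁆ = reach z∈S ◅◅ zRw ◅ ε
  ... | no no-exit = S , x∈S , record { next = stay } , reach
    where
    stay : ∀ {z} → z ∈ S → ∀ {w} → R z w → w ∈ S
    stay {z} z∈S {w} zRw with w ∈? S
    ... | yes w∈S = w∈S
    ... | no w∉S = contradiction (z , w , z∈S , w∉S , zRw) no-exit

  closedReachableSet : ClosedReachableSet
  closedReachableSet = saturate ⁅ x ⁆ (⊃-wellFounded ⁅ x ⁆) (x∈⁅x⁆ x)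
    (λ y∈⁅x⁆ → subst (Star R x) (sym (x∈⁅y⁆⇒x≡y x y∈⁅x⁆)) ε)

module OrientationDigraph {m n} (c : Fin m → Sign) (r : Fin n → Sign) (π : Gridded m n) where

  Arc? : B.Decidable (Arc c r π)
  Arc? x y = (col π x Finₚ.≟ col π y ×-dec Precedes? (c (col π x)) x y)
       ⊎-dec (row π x Finₚ.≟ row π y ×-dec Precedes? (r (row π x)) (perm π x) (perm π y))

  ArcClosed : Subset (size π) → Set
  ArcClosed T = Closed (Arc c r π) (_∈ T)

  module _ {T} (closed : ArcClosed T) {x y} (x∉T : x ∉ T) (y∈T : y ∈ T) where

    private
      x≢y : x ≢ y
      x≢y refl = x∉T y∈T

    closed⇒ColPrec : col π x ≡ col π y → ColPrec c π x y
    closed⇒ColPrec same with Precedes-connex (c (col π x)) x≢y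
    ... | inj₁ x≺y = same , x≺y
    ... | inj₂ y≺x = contradiction (Closed.next closed y∈T y⟶x) x∉T
      where
      y⟶x : Arc c r π y x
      y⟶x = inj₁ (sym same , subst (λ i → Precedes (c i) y x) same y≺x)

    closed⇒RowPrec : row π x ≡ row π y → RowPrec r π x y
    closed⇒RowPrec same with Precedes-connex (r (row π x)) (x≢y ∘ perm-inj π)
    ... | inj₁ x≺y = same , x≺y
    ... | inj₂ y≺x = contradiction (Closed.next closed y∈T y⟶x) x∉T
      where
      y⟶x : Arc c r π y x
      y⟶x = inj₂ (sym same , subst (λ i → Precedes (r i) (perm π y) (perm π x)) same y≺x)

  module Split (T : Subset (size π)) where
    module Out = Restriction π (∁ T)
    module In  = Restriction π T

    outside-T : ∀ a → enum (∁ T) a ∉ T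
    outside-T a = x∈∁p⇒x∉p (enum-∈ (∁ T) a)

    split : Fin ∣ ∁ T ∣ ⊎ Fin ∣ T ∣ → Fin (size π)
    split (inj₁ a) = enum (∁ T) a
    split (inj₂ b) = enum T b

    split-injective : Injective _≡_ _≡_ split
    split-injective {inj₁ a} {inj₁ a′} eq = cong inj₁ (StrictlyMonotone.injective (enum-strictMono (∁ T)) eq)
    split-injective {inj₂ b} {inj₂ b′} eq = cong inj₂ (StrictlyMonotone.injective (enum-strictMono T) eq)
    split-injective {inj₁ a} {inj₂ b} eq = contradiction (subst (_∈ T) (sym eq) (enum-∈ T b)) (outside-T a)
    split-injective {inj₂ b} {inj₁ a} eq = contradiction (subst (_∈ T) eq (enum-∈ T b)) (outside-T a)

    split-surjective : Surjective _≡_ _≡_ split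
    split-surjective p with p ∈? T
    ... | yes p∈T = inj₂ (index p∈T) , λ { refl → enum-index p∈T }
    ... | no p∉T = inj₁ (index (x∉p⇒x∈∁p p∉T)) , λ { refl → enum-index (x∉p⇒x∈∁p p∉T) }

    closed⇒MSum : ArcClosed T → IsMSum c r π Out.restrict In.restrict
    closed⇒MSum closed = record
      { e      = split
      ; e-bij  = split-injective , split-surjective
      ; colˡ   = λ _ → refl
      ; rowˡ   = sym ∘ Out.row-restrict
      ; colʳ   = λ _ → refl
      ; rowʳ   = sym ∘ In.row-restrict
      ; posˡ   = λ _ _ → enum-strictMono (∁ T)
      ; valˡ   = λ _ _ → Out.rank-reflects-<
      ; posʳ   = λ _ _ → enum-strictMono T
      ; valʳ   = λ _ _ → In.rank-reflects-<
      ; colSep = λ a b → closed⇒ColPrec closed (outside-T a) (enum-∈ T b)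
      ; rowSep = λ a b same → closed⇒RowPrec closed (outside-T a) (enum-∈ T b)
                                (trans (sym (Out.row-restrict a)) (trans same (In.row-restrict b)))
      }

  closed⇒MDivisible : ∀ M {T x y} → InGrid M π → ArcClosed T → x ∉ T → y ∈ T → MDivisible M c r π
  closed⇒MDivisible M {T} grid closed x∉T y∈T =
    Out.restrict , In.restrict , Out.restrict-inGrid M grid , In.restrict-inGrid M grid ,
    index (x∉p⇒x∈∁p x∉T) , index y∈T , closed⇒MSum closed
    where open Split T

  MIndivisible⇒StronglyConnected : ∀ M → InGrid M π → MIndivisible M c r π → StronglyConnected c r π
  MIndivisible⇒StronglyConnected M grid indivisible x y
    with T , x∈T , closed , reached ← Reachability.closedReachableSet Arc? x
    with y ∈? T
  ... | yes y∈T = reached y∈T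
  ... | no y∉T = contradiction (closed⇒MDivisible M grid closed y∉T x∈T) indivisible

  module _ {σ τ} (σ⊞τ : IsMSum c r π σ τ) where
    open IsMSum σ⊞τ

    no-arc-from-τ-to-σ : ∀ a b → ¬ Arc c r π (e (inj₂ b)) (e (inj₁ a))
    no-arc-from-τ-to-σ a b (inj₁ (same , b≺a))
      with _ , a≺b ← colSep a b (trans (sym (colˡ a)) (trans (sym same) (colʳ b)))
      = Precedes-asym (c (col π (e (inj₁ a)))) a≺b (subst (λ i → Precedes (c i) _ _) same b≺a)
    no-arc-from-τ-to-σ a b (inj₂ (same , b≺a))
      with _ , a≺b ← rowSep a b (trans (sym (rowˡ a)) (trans (sym same) (rowʳ b)))
      = Precedes-asym (r (row π (e (inj₁ a)))) a≺b (subst (λ i → Precedes (r i) _ _) same b≺a)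

    InImageOfτ : Fin (size π) → Set
    InImageOfτ p = ∃ λ b → e (inj₂ b) ≡ p

    imageOfτ-closed : Closed (Arc c r π) InImageOfτ
    imageOfτ-closed = record { next = next }
      where
      next : ∀ {p} → InImageOfτ p → ∀ {q} → Arc c r π p q → InImageOfτ q
      next (b , refl) {q} arc with proj₂ e-bij q
      ... | inj₂ b′ , e≡q = b′ , e≡q refl
      ... | inj₁ a , e≡q rewrite sym (e≡q refl) = contradiction arc (no-arc-from-τ-to-σ a b)

    MSum⇒¬StronglyConnected : NonEmpty σ → NonEmpty τ → ¬ StronglyConnected c r π
    MSum⇒¬StronglyConnected a b connected
      with b′ , e≡ ← Closed⇒Star-closed imageOfτ-closed (b , refl) (connected (e (inj₂ b)) (e (inj₁ a)))
      with () ← proj₁ e-bij e≡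

  StronglyConnected⇒MIndivisible : ∀ M → StronglyConnected c r π → MIndivisible M c r π
  StronglyConnected⇒MIndivisible M connected (_ , _ , _ , _ , a , b , σ⊞τ) =
    MSum⇒¬StronglyConnected σ⊞τ a b connected

open OrientationDigraph

lemma3p2 : ∀ {m n} (M : GriddingMatrix m n) (c : Fin m → Sign) (r : Fin n → Sign) →
    IsPartialMultiplication M c r →
    (π : Gridded m n) → InGrid M π →
    MIndivisible M c r π ⇔ StronglyConnected c r π
lemma3p2 M c r _ π grid = mk⇔
  (MIndivisible⇒StronglyConnected c r π M grid)
  (StronglyConnected⇒MIndivisible c r π M)
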